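{- Let $T$ be a finite simplicial complex with vertex set $X$. Then $T$ is the $K$-complex of some partial order $\le$ on $X$ if and only if for every maximal simplex $s$ of $T$ there exists $y\in s$ such that $y\notin s'$ for every maximal simplex $s'\neq s$ of $T$.
   Context: The $K$-complex of a poset $(X,\le)$ is the simplicial complex whose simplices are the nonempty subsets $\{x_0,\dots,x_n\}\subseteq X$ for which there exists $y\in X$ with $x_i\le y$ for all $i$. -}

module Defs where

open import Level using (0ℓ)
open import Data.Nat using (ℕ)
open import Data.Fin using (Fin)
open import Data.Fin.Subset using (Subset; _∈_; _∉_; _⊆_; Nonempty)
open import Data.Product using (Σ; ∃; _×_; _,_)
open import Relation.Binary.PropositionalEquality using (_≡_)
open import Relation.Binary.Structures using (IsPartialOrder)
open import Relation.Nullary using (Dec; ¬_)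
open import Function.Bundles using (_⇔_)

-- Simplices are nonempty subsets of the vertex set; the family is closed
-- under nonempty subsets, and every vertex is a 0-simplex (so the vertex
-- set of T is exactly Fin n).
record SimplicialComplex (n : ℕ) : Set₁ where
  field
    IsSimplex   : Subset n → Set
    simplex?    : (s : Subset n) → Dec (IsSimplex s)
    nonempty    : ∀ {s} → IsSimplex s → Nonempty s
    downClosed  : ∀ {s t} → IsSimplex s → Nonempty t → t ⊆ s → IsSimplex t
    vertices    : ∀ (x : Fin n) → Σ (Subset n) λ s → IsSimplex s × x ∈ s

open SimplicialComplex public

record PartialOrder (n : ℕ) : Set₁ where
  field
    _≤_       : Fin n → Fin n → Set
    isPartial : IsPartialOrder _≡_ _≤_

open PartialOrder public

IsKSimplex : ∀ {n} → PartialOrder n → Subset n → Set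
IsKSimplex P s = Nonempty s × ∃ λ y → ∀ {x} → x ∈ s → _≤_ P x y

IsKComplexOf : ∀ {n} → SimplicialComplex n → PartialOrder n → Set
IsKComplexOf {n} T P = ∀ (s : Subset n) → IsSimplex T s ⇔ IsKSimplex P s

IsMaximal : ∀ {n} → SimplicialComplex n → Subset n → Set
IsMaximal T s = IsSimplex T s × (∀ t → IsSimplex T t → s ⊆ t → t ≡ s)

HasPrivateVertices : ∀ {n} → SimplicialComplex n → Set
HasPrivateVertices {n} T =
  ∀ s → IsMaximal T s →
    ∃ λ (y : Fin n) → y ∈ s × (∀ s' → IsMaximal T s' → ¬ (s' ≡ s) → y ∉ s')

{-# OPTIONS --safe #-}
module Submission where

-- If T is the K-complex of P and y bounds a maximal simplex s, then
-- s ∪ {y} is bounded by y, so y ∈ s; and y lies in no other maximal simplex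
-- s', since an upper bound of s' would bound s ∪ s'. Conversely, pick a
-- private vertex apex(s) of every maximal simplex s and let x ≼ y mean x ≡ y
-- or x ∈ s with y = apex(s). Private vertices make every maximal simplex
-- ≼-down-closed, which gives transitivity and antisymmetry, and the
-- ≼-bounded sets are exactly the faces of maximal simplices.

open import Defs
open import Data.Nat using (ℕ)
open import Data.Product using (∃; Σ; _×_; _,_; proj₁; proj₂)
open import Data.Sum using (_⊎_; inj₁; inj₂)
open import Data.Bool using (_≟_)
open import Data.Vec.Properties using (≡-dec)
open import Data.Fin using (Fin)
open import Data.Fin.Subset using (Subset; _∈_; _∉_; _⊆_; _⊂_; _⊃_; _∪_; ⁅_⁆; Nonempty)
open import Data.Fin.Subset.Properties
  using (_∈?_; _⊂?_; anySubset?; ⊆-antisym; p⊆p∪q; q⊆p∪q; x∈p∪q⁻; x∈⁅x⁆; x∈⁅y⁆⇒x≡y)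
open import Data.Fin.Subset.Induction using (⊃-wellFounded)
open import Induction.WellFounded using (Acc; acc)
open import Function using (_∘_; id)
open import Function.Bundles using (_⇔_; mk⇔; Equivalence)
open import Relation.Binary.PropositionalEquality using (_≡_; refl; sym; subst; isEquivalence)
open import Relation.Binary.Structures using (IsPartialOrder)
open import Relation.Nullary using (Dec; yes; no; ¬_; ¬?)
open import Relation.Nullary.Decidable using (_×-dec_; decidable-stable; recompute; map)

module _ {n : ℕ} (T : SimplicialComplex n) where

  HasProperCoface : Subset n → Set
  HasProperCoface t = ∃ λ u → IsSimplex T u × t ⊂ u

  hasProperCoface? : ∀ t → Dec (HasProperCoface t)
  hasProperCoface? t = anySubset? λ u → simplex? T u ×-dec t ⊂? u

  noProperCoface⇔isMaximal : ∀ {t} → (IsSimplex T t × ¬ HasProperCoface t) ⇔ IsMaximal T t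
  noProperCoface⇔isMaximal {t} = mk⇔ to from
    where
    from : IsMaximal T t → IsSimplex T t × ¬ HasProperCoface t
    from (tS , maximal) = tS , λ (u , uS , t⊆u , x , x∈u , x∉t) →
      x∉t (subst (x ∈_) (maximal u uS t⊆u) x∈u)

    to : IsSimplex T t × ¬ HasProperCoface t → IsMaximal T t
    to (tS , noCoface) = tS , λ u uS t⊆u → ⊆-antisym (u⊆t uS t⊆u) t⊆u
      where
      u⊆t : ∀ {u} → IsSimplex T u → t ⊆ u → u ⊆ t
      u⊆t {u} uS t⊆u {x} x∈u =
        decidable-stable (x ∈? t) λ x∉t → noCoface (u , uS , t⊆u , x , x∈u , x∉t)

  isMaximal? : ∀ t → Dec (IsMaximal T t)
  isMaximal? t =
    map noProperCoface⇔isMaximal (simplex? T t ×-dec ¬? (hasProperCoface? t))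

  maximalCoface : ∀ {t} → IsSimplex T t → ∃ λ s → IsMaximal T s × t ⊆ s
  maximalCoface {t} = go (⊃-wellFounded t)
    where
    go : ∀ {t} → Acc _⊃_ t → IsSimplex T t → ∃ λ s → IsMaximal T s × t ⊆ s
    go {t} (acc larger) tS with hasProperCoface? t
    ... | no noCoface = t , Equivalence.to noProperCoface⇔isMaximal (tS , noCoface) , id
    ... | yes (u , uS , t⊂u) with go (larger t⊂u) uS
    ...   | s , sMax , u⊆s = s , sMax , u⊆s ∘ proj₁ t⊂u

  maximalSimplexContaining : ∀ x → ∃ λ s → IsMaximal T s × x ∈ s
  maximalSimplexContaining x with vertices T x
  ... | v , vS , x∈v with maximalCoface vS
  ...   | s , sMax , v⊆s = s , sMax , v⊆s x∈v

  maximal-absorbs : ∀ {s t} → IsMaximal T s → IsSimplex T (s ∪ t) → t ⊆ s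
  maximal-absorbs {s} {t} (_ , maximal) s∪tS x∈t =
    subst (_ ∈_) (maximal (s ∪ t) s∪tS (p⊆p∪q t)) (q⊆p∪q s t x∈t)

  PrivateVertex : Subset n → Fin n → Set
  PrivateVertex s y = ∀ s' → IsMaximal T s' → ¬ (s' ≡ s) → y ∉ s'

  privateVertex-owner : ∀ {s s' y} → PrivateVertex s y → IsMaximal T s' → y ∈ s' → s' ≡ s
  privateVertex-owner {s} {s'} private' s'Max y∈s' =
    decidable-stable (≡-dec _≟_ s' s) λ s'≢s → private' s' s'Max s'≢s y∈s'

module _ {n : ℕ} (P : PartialOrder n) where

  open IsPartialOrder (isPartial P) using () renaming (refl to ≤-refl; trans to ≤-trans)

  UpperBound : Subset n → Fin n → Set
  UpperBound s y = ∀ {x} → x ∈ s → _≤_ P x y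

  ∪-upperBound : ∀ {s t y z} → UpperBound s y → UpperBound t z → _≤_ P y z → UpperBound (s ∪ t) z
  ∪-upperBound {s} {t} s≤y t≤z y≤z x∈s∪t with x∈p∪q⁻ s t x∈s∪t
  ... | inj₁ x∈s = ≤-trans (s≤y x∈s) y≤z
  ... | inj₂ x∈t = t≤z x∈t

  ∪⁅⁆-upperBound : ∀ {s y} → UpperBound s y → UpperBound (s ∪ ⁅ y ⁆) y
  ∪⁅⁆-upperBound {y = y} s≤y = ∪-upperBound s≤y ⁅y⁆≤y ≤-refl
    where
    ⁅y⁆≤y : UpperBound ⁅ y ⁆ y
    ⁅y⁆≤y x∈⁅y⁆ = subst (λ x → _≤_ P x y) (sym (x∈⁅y⁆⇒x≡y y x∈⁅y⁆)) ≤-refl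

kComplex⇒privateVertices : ∀ {n} (T : SimplicialComplex n) (P : PartialOrder n) →
                           IsKComplexOf T P → HasPrivateVertices T
kComplex⇒privateVertices T P kComplex s sMax@(sS , _)
  with Equivalence.to (kComplex s) sS
... | _ , y , s≤y = y , y∈s , y-private
  where
  boundedSimplex : ∀ {t z} → Nonempty t → UpperBound P t z → IsSimplex T t
  boundedSimplex {t} ne t≤z = Equivalence.from (kComplex t) (ne , _ , t≤z)

  y∈⁅y⁆ : y ∈ ⁅ y ⁆
  y∈⁅y⁆ = x∈⁅x⁆ y

  y∈s : y ∈ s
  y∈s = maximal-absorbs T sMax
    (boundedSimplex (y , q⊆p∪q s ⁅ y ⁆ y∈⁅y⁆) (∪⁅⁆-upperBound P s≤y))
    y∈⁅y⁆

  y-private : PrivateVertex T s y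
  y-private s' (s'S , maximal') s'≢s y∈s' with Equivalence.to (kComplex s') s'S
  ... | _ , _ , s'≤y' = s'≢s (sym (maximal' s sS s'⊆s))
    where
    s'⊆s : s' ⊆ s
    s'⊆s = maximal-absorbs T sMax
      (boundedSimplex (y , q⊆p∪q s s' y∈s') (∪-upperBound P s≤y s'≤y' (s'≤y' y∈s')))

module PrivateVertexOrder {n : ℕ} (T : SimplicialComplex n) (H : HasPrivateVertices T) where

  -- The apex is read off a recomputed proof of maximality, so it does not depend
  -- on the proof supplied; antisymmetry of _≼_ relies on this.
  apex : ∀ {s} → .(IsMaximal T s) → Fin n
  apex {s} sMax = proj₁ (H s (recompute (isMaximal? T s) sMax))

  apex-owner : ∀ {s s'} (sMax : IsMaximal T s) → IsMaximal T s' → apex sMax ∈ s' → s' ≡ s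
  apex-owner {s} sMax = privateVertex-owner T (proj₂ (proj₂ (H s (recompute (isMaximal? T s) sMax))))

  _≼_ : Fin n → Fin n → Set
  x ≼ y = x ≡ y ⊎ ∃ λ s → Σ (IsMaximal T s) λ sMax → x ∈ s × apex sMax ≡ y

  maximal-≼-downClosed : ∀ {s x y} → IsMaximal T s → y ∈ s → x ≼ y → x ∈ s
  maximal-≼-downClosed _ y∈s (inj₁ refl) = y∈s
  maximal-≼-downClosed s'Max apex∈s' (inj₂ (s , sMax , x∈s , refl)) =
    subst (_ ∈_) (sym (apex-owner sMax s'Max apex∈s')) x∈s

  ≼-trans : ∀ {x y z} → x ≼ y → y ≼ z → x ≼ z
  ≼-trans x≼y (inj₁ refl) = x≼y
  ≼-trans x≼y (inj₂ (s , sMax , y∈s , apex≡z)) =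
    inj₂ (s , sMax , maximal-≼-downClosed sMax y∈s x≼y , apex≡z)

  ≼-antisym : ∀ {x y} → x ≼ y → y ≼ x → x ≡ y
  ≼-antisym (inj₁ x≡y) _ = x≡y
  ≼-antisym _ (inj₁ y≡x) = sym y≡x
  ≼-antisym (inj₂ (s , sMax , _ , refl)) (inj₂ (s' , s'Max , apex∈s' , refl))
    with apex-owner sMax s'Max apex∈s'
  ... | refl = refl

  order : PartialOrder n
  order = record
    { _≤_       = _≼_
    ; isPartial = record
      { isPreorder = record { isEquivalence = isEquivalence ; reflexive = inj₁ ; trans = ≼-trans }
      ; antisym    = ≼-antisym
      }
    }

  isKComplexOf-order : IsKComplexOf T order
  isKComplexOf-order t = mk⇔ to from
    where
    to : IsSimplex T t → IsKSimplex order t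
    to tS with maximalCoface T tS
    ... | s , sMax , t⊆s = nonempty T tS , apex sMax , λ x∈t → inj₂ (s , sMax , t⊆s x∈t , refl)

    from : IsKSimplex order t → IsSimplex T t
    from (ne , y , t≼y) with maximalSimplexContaining T y
    ... | s , sMax@(sS , _) , y∈s =
      downClosed T sS ne λ x∈t → maximal-≼-downClosed sMax y∈s (t≼y x∈t)

mainTheorem8 : ∀ (n : ℕ) (T : SimplicialComplex n) →
    (∃ λ (P : PartialOrder n) → IsKComplexOf T P) ⇔ HasPrivateVertices T
mainTheorem8 n T = mk⇔
  (λ (P , kComplex) → kComplex⇒privateVertices T P kComplex)
  (λ H → order H , isKComplexOf-order H)
  where open PrivateVertexOrder T
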